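{- Let $n\ge3$ and let $\mathbb X=\langle X,\rho\rangle$ be a $\mathbb K_n$-free graph. Then: (a) $\mathbb X$ is a maximal $\mathbb K_n$-free graph iff for every $\{x,y\}\in[X]^2\setminus\rho$ there is $K\in[X]^n$ with $[K]^2\setminus\rho=\{\{x,y\}\}$; (b) if $\mathbb X$ is a maximal $\mathbb K_n$-free graph and $|X|\ge n-1$, then for every $x\in X$ there is $K\in[X\setminus\{x\}]^{n-2}$ such that the subgraph induced on $\{x\}\cup K$ is isomorphic to $\mathbb K_{n-1}$; (c) if $\mathbb X$ is a maximal $\mathbb K_n$-free graph, $|X|\ge n-1$, $\{Y_x:x\in X\}$ is a family of non-empty sets, $Y=\bigcup_{x\in X}\{x\}\times Y_x$ and $\sigma=\{\{\langle x,y\rangle,\langle x',y'\rangle\}\in[Y]^2:\{x,x'\}\in\rho\}$, then $\langle Y,\sigma\rangle$ is a maximal $\mathbb K_n$-free graph; (d) $\mathbb X$ is a maximal $\mathbb K_n$-free graph iff $\mathbb X^c$ is a minimal $\langle n,\Delta_n\rangle$-free reflexive graph iff $\mathbb X^{gc}$ is a minimal $\mathbb E_n$-free graph.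
   Context: A graph $\langle X,\rho\rangle$ is identified with its edge set $\rho\subseteq[X]^2$ (equivalently an irreflexive symmetric binary relation). $\mathbb K_\nu$ is the complete graph on $\nu$ vertices and $\mathbb E_\nu$ the graph on $\nu$ vertices with no edges. A graph is $\mathbb K_n$-free iff it has no subgraph isomorphic to $\mathbb K_n$, i.e. no $K\in[X]^n$ with $[K]^2\subseteq\rho$; it is $\mathbb E_n$-free iff no $K\in[X]^n$ has $[K]^2\cap\rho=\emptyset$. A maximal (minimal) $\mathbb K_n$-free ($\mathbb E_n$-free) graph on $X$ is one that is maximal (minimal) under inclusion of edge sets among such graphs on the same vertex set $X$. $\mathbb X^{gc}=\langle X,[X]^2\setminus\rho\rangle$ is the graph complement. $\mathbb X^c=\langle X,X^2\setminus\rho\rangle$, where $\rho$ is viewed as a binary relation; it is a reflexive symmetric relation (reflexive graph). A reflexive graph $\langle X,\theta\rangle$ is $\langle n,\Delta_n\rangle$-free iff no $K\in[X]^n$ has $\theta\cap K^2=\Delta_K$ (the diagonal of $K$), and minimal such means minimal under inclusion among reflexive symmetric $\langle n,\Delta_n\rangle$-free relations on $X$. -}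

module Defs where

open import Level using (0ℓ)
open import Data.Nat using (ℕ; _∸_)
open import Data.Fin using (Fin)
open import Data.Product using (Σ; Σ-syntax; _×_; _,_)
open import Data.Sum using (_⊎_)
open import Relation.Nullary using (¬_)
open import Relation.Binary.PropositionalEquality using (_≡_; _≢_)
open import Function.Definitions using (Injective)

Rel₀ : Set → Set₁
Rel₀ X = X → X → Set

_⊆ᵣ_ : {X : Set} → Rel₀ X → Rel₀ X → Set
ρ ⊆ᵣ σ = ∀ x y → ρ x y → σ x y

-- A graph: irreflexive symmetric relation ({x,y} ∈ ρ  ↔  ρ x y).
IsGraph : {X : Set} → Rel₀ X → Set
IsGraph {X} ρ = (∀ (x y : X) → ρ x y → ρ y x) × (∀ (x : X) → ¬ ρ x x)

IsReflGraph : {X : Set} → Rel₀ X → Set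
IsReflGraph {X} θ = (∀ (x y : X) → θ x y → θ y x) × (∀ (x : X) → θ x x)

-- An n-element subset K ∈ [X]^n, given by an injective enumeration Fin n → X.
Sub : Set → ℕ → Set
Sub X n = Σ (Fin n → X) λ f → Injective _≡_ _≡_ f

-- |X| ≥ m : X has an m-element subset.
CardGE : Set → ℕ → Set
CardGE X m = Sub X m

Complete : {X : Set} {n : ℕ} → Rel₀ X → Sub X n → Set
Complete ρ (f , _) = ∀ i j → i ≢ j → ρ (f i) (f j)

Independent : {X : Set} {n : ℕ} → Rel₀ X → Sub X n → Set
Independent ρ (f , _) = ∀ i j → i ≢ j → ¬ ρ (f i) (f j)

KFree : {X : Set} → ℕ → Rel₀ X → Set
KFree {X} n ρ = ¬ Σ (Sub X n) (Complete ρ)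

EFree : {X : Set} → ℕ → Rel₀ X → Set
EFree {X} n ρ = ¬ Σ (Sub X n) (Independent ρ)

DiagOn : {X : Set} {n : ℕ} → Rel₀ X → Sub X n → Set
DiagOn θ (f , _) = ∀ i j → (θ (f i) (f j) → f i ≡ f j) × (f i ≡ f j → θ (f i) (f j))

DFree : {X : Set} → ℕ → Rel₀ X → Set
DFree {X} n θ = ¬ Σ (Sub X n) (DiagOn θ)

MaxKFree : {X : Set} → ℕ → Rel₀ X → Set₁
MaxKFree {X} n ρ =
  IsGraph ρ × KFree n ρ ×
  (∀ (σ : Rel₀ X) → IsGraph σ → KFree n σ → ρ ⊆ᵣ σ → σ ⊆ᵣ ρ)

MinEFree : {X : Set} → ℕ → Rel₀ X → Set₁
MinEFree {X} n ρ =
  IsGraph ρ × EFree n ρ ×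
  (∀ (σ : Rel₀ X) → IsGraph σ → EFree n σ → σ ⊆ᵣ ρ → ρ ⊆ᵣ σ)

MinDFree : {X : Set} → ℕ → Rel₀ X → Set₁
MinDFree {X} n θ =
  IsReflGraph θ × DFree n θ ×
  (∀ (θ' : Rel₀ X) → IsReflGraph θ' → DFree n θ' → θ' ⊆ᵣ θ → θ ⊆ᵣ θ')

compl : {X : Set} → Rel₀ X → Rel₀ X
compl ρ x y = ¬ ρ x y

gcompl : {X : Set} → Rel₀ X → Rel₀ X
gcompl ρ x y = x ≢ y × ¬ ρ x y

-- [K]^2 \ ρ = {{x,y}}
OnlyMissing : {X : Set} {n : ℕ} → Rel₀ X → Sub X n → X → X → Set
OnlyMissing ρ (f , _) x y =
  (Σ[ i ∈ _ ] Σ[ j ∈ _ ] (f i ≡ x × f j ≡ y)) ×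
  (∀ i j → i ≢ j → ¬ ρ (f i) (f j) →
     (f i ≡ x × f j ≡ y) ⊎ (f i ≡ y × f j ≡ x))

BlowUp : {X : Set} → Rel₀ X → (Y : X → Set) → Rel₀ (Σ X Y)
BlowUp ρ Y (x , y) (x' , y') = ((x , y) ≢ (x' , y')) × ρ x x'

-- Claim 5.3 on maximal K_n-free graphs, proved for n = k + 2 (so n ≥ 2 suffices).
--
-- Call ρ saturated (for n) when every non-edge {x,y} is the unique pair of some n-set
-- missing from ρ; for x ≠ y such an n-set is the same as a common clique of x and y:
-- a k-clique avoiding x, y whose members are adjacent to both (delete / re-add x, y).
--  (a) maximal ⇒ saturated, since adding the non-edge {x,y} creates an n-clique which
--      must use the new edge; saturated ⇒ maximal, since a new edge {x,y} would
--      complete the n-set attached to it.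
--  (b) in a saturated graph on ≥ k+1 vertices every x has a common clique with itself:
--      via a non-neighbour of x, or else by deleting x from some (k+1)-clique.
--  (c) common cliques lift to the blow-up, which is therefore saturated, hence maximal.
--  (d) X² ∖ ρ and [X]² ∖ ρ reverse inclusion and exchange K_n-free graphs with
--      ⟨n,Δ_n⟩-free reflexive graphs resp. E_n-free graphs; an abstract lemma on such
--      dualities turns maximality into minimality.
module Submission where

open import Defs
open import Axiom.ExcludedMiddle using (ExcludedMiddle)
open import Axiom.DoubleNegationElimination using (em⇒dne)
open import Level using (0ℓ)
open import Data.Nat using (ℕ; _≤_; _∸_; suc; s≤s)
open import Data.Fin using (Fin; zero; suc; punchIn)
open import Data.Fin.Properties using (punchIn-injective; punchInᵢ≢i) renaming (_≟_ to _≟ᶠ_)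
open import Data.Vec.Functional using (_∷_)
open import Data.Product using (Σ; Σ-syntax; _×_; _,_; proj₁; proj₂)
open import Data.Sum using (_⊎_; inj₁; inj₂; [_,_])
open import Data.Empty using (⊥; ⊥-elim)
open import Relation.Nullary using (¬_; yes; no)
open import Relation.Binary.PropositionalEquality using (_≡_; _≢_; refl; sym; trans; cong; subst; subst₂)
open import Function using (id)
open import Function.Bundles using (_⇔_; mk⇔)
open import Function.Construct.Symmetry using (⇔-sym)
open import Function.Construct.Composition using (_⇔-∘_)
open import Function.Definitions using (Injective)

private
  variable
    X : Set
    k m n : ℕ

⊆-trans : {ρ σ τ : Rel₀ X} → ρ ⊆ᵣ σ → σ ⊆ᵣ τ → ρ ⊆ᵣ τ
⊆-trans ρ⊆σ σ⊆τ a b r = σ⊆τ a b (ρ⊆σ a b r)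

edge⇒distinct : {ρ : Rel₀ X} → IsGraph ρ → ∀ {a b} → ρ a b → a ≢ b
edge⇒distinct (_ , irr) {b = b} r refl = irr b r

IsPair : X → X → X → X → Set
IsPair x y a b = (a ≡ x × b ≡ y) ⊎ (a ≡ y × b ≡ x)

_∈ₛ_ : X → Sub X m → Set
x ∈ₛ (f , _) = Σ[ i ∈ Fin _ ] f i ≡ x

restrict : (K : Sub X m) (θ : Fin k → Fin m) → Injective _≡_ _≡_ θ → Sub X k
restrict (f , f-inj) θ θ-inj = (λ l → f (θ l)) , (λ e → θ-inj (f-inj e))

complete-restrict : {ρ : Rel₀ X} (K : Sub X m) (θ : Fin k → Fin m) (θ-inj : Injective _≡_ _≡_ θ) →
  Complete ρ K → Complete ρ (restrict K θ θ-inj)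
complete-restrict K θ θ-inj c i j i≢j = c (θ i) (θ j) (λ e → i≢j (θ-inj e))

record Avoiding (K : Sub X m) (k : ℕ) (a b : X) : Set where
  field
    index           : Fin k → Fin m
    index-injective : Injective _≡_ _≡_ index
    avoids-a        : ∀ l → proj₁ K (index l) ≢ a
    avoids-b        : ∀ l → proj₁ K (index l) ≢ b

  members : Sub X k
  members = restrict K index index-injective

cons-injective : {a : X} {f : Fin k → X} → Injective _≡_ _≡_ f → (∀ l → f l ≢ a) →
  Injective _≡_ _≡_ (a ∷ f)
cons-injective f-inj fresh {zero}  {zero}  _ = refl
cons-injective f-inj fresh {zero}  {suc j} e = ⊥-elim (fresh j (sym e))
cons-injective f-inj fresh {suc i} {zero}  e = ⊥-elim (fresh i e)
cons-injective f-inj fresh {suc i} {suc j} e = cong suc (f-inj e)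

extend : (a : X) (K : Sub X k) → (∀ l → proj₁ K l ≢ a) → Sub X (suc k)
extend a (f , f-inj) fresh = (a ∷ f) , cons-injective f-inj fresh

complete-extend : {ρ : Rel₀ X} {a : X} (K : Sub X k) (fresh : ∀ l → proj₁ K l ≢ a) →
  (∀ x y → ρ x y → ρ y x) → Complete ρ K → (∀ l → ρ a (proj₁ K l)) → Complete ρ (extend a K fresh)
complete-extend K fresh ρ-sym c adjacent zero    zero     0≢0   = ⊥-elim (0≢0 refl)
complete-extend K fresh ρ-sym c adjacent zero    (suc l)  _     = adjacent l
complete-extend K fresh ρ-sym c adjacent (suc l) zero     _     = ρ-sym _ _ (adjacent l)
complete-extend K fresh ρ-sym c adjacent (suc l) (suc l') l≢l' = c l l' (λ e → l≢l' (cong suc e))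

Saturated : ℕ → Rel₀ X → Set
Saturated {X} n ρ = ∀ (x y : X) → x ≢ y → ¬ ρ x y → Σ[ K ∈ Sub X n ] OnlyMissing ρ K x y

addEdge : Rel₀ X → X → X → Rel₀ X
addEdge ρ x y a b = ρ a b ⊎ IsPair x y a b

addEdge-isGraph : {ρ : Rel₀ X} {x y : X} → IsGraph ρ → x ≢ y → IsGraph (addEdge ρ x y)
addEdge-isGraph (ρ-sym , ρ-irr) x≢y =
  (λ a b → [ (λ r → inj₁ (ρ-sym a b r)) , (λ p → inj₂ (swap p)) ]) ,
  (λ a → [ ρ-irr a , (λ { (inj₁ (p , q)) → x≢y (trans (sym p) q)
                        ; (inj₂ (p , q)) → x≢y (trans (sym q) p) }) ])
  where
  swap : ∀ {x y a b} → IsPair x y a b → IsPair x y b a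
  swap (inj₁ (p , q)) = inj₂ (q , p)
  swap (inj₂ (p , q)) = inj₁ (q , p)

complete-dropEdge : {ρ : Rel₀ X} {x y : X} (K : Sub X n) → ¬ x ∈ₛ K ⊎ ¬ y ∈ₛ K →
  Complete (addEdge ρ x y) K → Complete ρ K
complete-dropEdge {x = x} {y} (f , _) missing c i j i≢j = [ id , (λ pair → ⊥-elim (misses pair)) ] (c i j i≢j)
  where
  misses : IsPair x y (f i) (f j) → ⊥
  misses (inj₁ (p , q)) = [ (λ x∉K → x∉K (i , p)) , (λ y∉K → y∉K (j , q)) ] missing
  misses (inj₂ (p , q)) = [ (λ x∉K → x∉K (j , q)) , (λ y∉K → y∉K (i , p)) ] missing

onlyMissing-of-complete-addEdge : {ρ : Rel₀ X} {x y : X} (K : Sub X n) → x ∈ₛ K → y ∈ₛ K →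
  Complete (addEdge ρ x y) K → OnlyMissing ρ K x y
onlyMissing-of-complete-addEdge K (i , fi≡x) (j , fj≡y) c =
  (i , j , fi≡x , fj≡y) , λ i j i≢j nonEdge → [ (λ r → ⊥-elim (nonEdge r)) , id ] (c i j i≢j)

record CommonClique (ρ : Rel₀ X) (k : ℕ) (x y : X) : Set where
  field
    clique     : Sub X k
    complete   : Complete ρ clique
    avoids-x   : ∀ l → proj₁ clique l ≢ x
    avoids-y   : ∀ l → proj₁ clique l ≢ y
    adjacent-x : ∀ l → ρ x (proj₁ clique l)
    adjacent-y : ∀ l → ρ y (proj₁ clique l)

commonClique-left : {ρ : Rel₀ X} {x y : X} → CommonClique ρ k x y → CommonClique ρ k x x
commonClique-left C = record
  { clique = clique ; complete = complete ; avoids-x = avoids-x ; avoids-y = avoids-x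
  ; adjacent-x = adjacent-x ; adjacent-y = adjacent-x }
  where open CommonClique C

onlyMissing-of-commonClique : {ρ : Rel₀ X} {x y : X} → IsGraph ρ → x ≢ y →
  CommonClique ρ k x y → Σ[ K ∈ Sub X (suc (suc k)) ] OnlyMissing ρ K x y
onlyMissing-of-commonClique {X = X} {k} {ρ} {x} {y} g x≢y C =
  K , onlyMissing-of-complete-addEdge {ρ = ρ} K (zero , refl) (suc zero , refl) K-complete
  where
  open CommonClique C

  fresh : ∀ l → (y ∷ proj₁ clique) l ≢ x
  fresh zero    = λ y≡x → x≢y (sym y≡x)
  fresh (suc l) = avoids-x l

  K : Sub X (suc (suc k))
  K = extend x (extend y clique avoids-y) fresh

  symmetric⁺ : ∀ a b → addEdge ρ x y a b → addEdge ρ x y b a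
  symmetric⁺ = proj₁ (addEdge-isGraph g x≢y)

  K-complete : Complete (addEdge ρ x y) K
  K-complete = complete-extend (extend y clique avoids-y) fresh symmetric⁺
    (complete-extend clique avoids-y symmetric⁺ (λ i j i≢j → inj₁ (complete i j i≢j)) (λ l → inj₁ (adjacent-y l)))
    λ { zero → inj₂ (inj₁ (refl , refl)) ; (suc l) → inj₁ (adjacent-x l) }

blowUp-isGraph : {ρ : Rel₀ X} (Y : X → Set) → IsGraph ρ → IsGraph (BlowUp ρ Y)
blowUp-isGraph Y (ρ-sym , _) =
  (λ p q (p≢q , r) → (λ e → p≢q (sym e)) , ρ-sym _ _ r) , (λ p (p≢p , _) → p≢p refl)

-- A clique of the blow-up projects injectively onto a clique of ρ.
blowUp-kFree : {ρ : Rel₀ X} (Y : X → Set) → IsGraph ρ → KFree n ρ → KFree n (BlowUp ρ Y)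
blowUp-kFree {X = X} {n = n} Y g kf ((f , f-inj) , c) = kf ((base , base-inj) , λ i j i≢j → proj₂ (c i j i≢j))
  where
  base : Fin n → X
  base i = proj₁ (f i)
  base-inj : Injective _≡_ _≡_ base
  base-inj {i} {j} e with i ≟ᶠ j
  ... | yes i≡j = i≡j
  ... | no  i≢j = ⊥-elim (edge⇒distinct g (proj₂ (c i j i≢j)) e)

liftCommonClique : {ρ : Rel₀ X} {Y : X → Set} → (∀ x → Y x) → (p q : Σ X Y) →
  CommonClique ρ k (proj₁ p) (proj₁ q) → CommonClique (BlowUp ρ Y) k p q
liftCommonClique {X = X} {k} {Y = Y} choice p q C = record
  { clique     = lift , (λ e → proj₂ clique (cong proj₁ e))
  ; complete   = λ i j i≢j → (λ e → i≢j (proj₂ clique (cong proj₁ e))) , complete i j i≢j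
  ; avoids-x   = λ l e → avoids-x l (cong proj₁ e)
  ; avoids-y   = λ l e → avoids-y l (cong proj₁ e)
  ; adjacent-x = λ l → (λ e → avoids-x l (sym (cong proj₁ e))) , adjacent-x l
  ; adjacent-y = λ l → (λ e → avoids-y l (sym (cong proj₁ e))) , adjacent-y l }
  where
  open CommonClique C
  lift : Fin k → Σ X Y
  lift l = proj₁ clique l , choice (proj₁ clique l)

IsMaximal : (Rel₀ X → Set) → Rel₀ X → Set₁
IsMaximal P ρ = ∀ σ → P σ → ρ ⊆ᵣ σ → σ ⊆ᵣ ρ

IsMinimal : (Rel₀ X → Set) → Rel₀ X → Set₁
IsMinimal Q θ = ∀ θ' → Q θ' → θ' ⊆ᵣ θ → θ ⊆ᵣ θ'

record Duality (P Q : Rel₀ X → Set) (F : Rel₀ X → Rel₀ X) : Set₁ where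
  field
    antitone  : ∀ {ρ σ} → ρ ⊆ᵣ σ → F σ ⊆ᵣ F ρ
    P⇒Q       : ∀ {ρ} → P ρ → Q (F ρ)
    Q⇒P       : ∀ {θ} → Q θ → P (F θ)
    FF-shrink : ∀ σ → F (F σ) ⊆ᵣ σ
    FF-grow   : ∀ {ρ} → P ρ → ρ ⊆ᵣ F (F ρ)

maximal⇔minimal : {P Q : Rel₀ X → Set} {F : Rel₀ X → Rel₀ X} → Duality P Q F →
  ∀ {ρ} → P ρ → IsMaximal P ρ ⇔ IsMinimal Q (F ρ)
maximal⇔minimal {P = P} {Q} {F} D {ρ} Pρ = mk⇔ toMinimal toMaximal
  where
  open Duality D
  toMinimal : IsMaximal P ρ → IsMinimal Q (F ρ)
  toMinimal max θ Qθ θ⊆Fρ =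
    ⊆-trans (antitone (max (F θ) (Q⇒P Qθ) (⊆-trans (FF-grow Pρ) (antitone θ⊆Fρ)))) (FF-shrink θ)
  toMaximal : IsMinimal Q (F ρ) → IsMaximal P ρ
  toMaximal min σ Pσ ρ⊆σ =
    ⊆-trans (FF-grow Pσ) (⊆-trans (antitone (min (F σ) (P⇒Q Pσ) (antitone ρ⊆σ))) (FF-shrink ρ))

KFreeGraph EFreeGraph DFreeReflGraph : ℕ → Rel₀ X → Set
KFreeGraph n ρ = IsGraph ρ × KFree n ρ
EFreeGraph n ρ = IsGraph ρ × EFree n ρ
DFreeReflGraph n θ = IsReflGraph θ × DFree n θ

maxKFree⇔isMaximal : {ρ : Rel₀ X} → KFreeGraph n ρ → MaxKFree n ρ ⇔ IsMaximal (KFreeGraph n) ρ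
maxKFree⇔isMaximal (g , kf) =
  mk⇔ (λ (_ , _ , max) σ (gσ , kσ) → max σ gσ kσ) (λ max → g , kf , λ σ gσ kσ → max σ (gσ , kσ))

minDFree⇔isMinimal : {θ : Rel₀ X} → DFreeReflGraph n θ → MinDFree n θ ⇔ IsMinimal (DFreeReflGraph n) θ
minDFree⇔isMinimal (g , df) =
  mk⇔ (λ (_ , _ , min) θ' (gθ' , dθ') → min θ' gθ' dθ') (λ min → g , df , λ θ' gθ' dθ' → min θ' (gθ' , dθ'))

minEFree⇔isMinimal : {θ : Rel₀ X} → EFreeGraph n θ → MinEFree n θ ⇔ IsMinimal (EFreeGraph n) θ
minEFree⇔isMinimal (g , ef) =
  mk⇔ (λ (_ , _ , min) θ' (gθ' , eθ') → min θ' gθ' eθ') (λ min → g , ef , λ θ' gθ' eθ' → min θ' (gθ' , eθ'))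

diagOn-of-complete-compl : {θ : Rel₀ X} → (∀ x → θ x x) → (K : Sub X n) → Complete (compl θ) K → DiagOn θ K
diagOn-of-complete-compl {θ = θ} θ-refl (f , _) c i j = onDiagonal , λ e → subst (θ (f i)) e (θ-refl (f i))
  where
  onDiagonal : θ (f i) (f j) → f i ≡ f j
  onDiagonal t with i ≟ᶠ j
  ... | yes i≡j = cong f i≡j
  ... | no  i≢j = ⊥-elim (c i j i≢j t)

gcompl-isGraph : {σ : Rel₀ X} → (∀ x y → σ x y → σ y x) → IsGraph (gcompl σ)
gcompl-isGraph σ-sym =
  (λ x y (x≢y , nσ) → (λ e → x≢y (sym e)) , (λ s → nσ (σ-sym y x s))) , (λ x (x≢x , _) → x≢x refl)

module Classical (em : ExcludedMiddle 0ℓ) where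

  dne : {P : Set} → ¬ ¬ P → P
  dne = em⇒dne em

  dropPoint : (K : Sub X (suc k)) (a : X) → Avoiding K k a a
  dropPoint (f , f-inj) a with em {a ∈ₛ (f , f-inj)}
  ... | yes (i , fi≡a) = record
        { index = punchIn i ; index-injective = punchIn-injective i _ _
        ; avoids-a = avoids ; avoids-b = avoids }
    where
    avoids : ∀ l → f (punchIn i l) ≢ a
    avoids l e = punchInᵢ≢i i l (f-inj (trans e (sym fi≡a)))
  ... | no a∉K = record
        { index = punchIn zero ; index-injective = punchIn-injective zero _ _
        ; avoids-a = λ l e → a∉K (_ , e) ; avoids-b = λ l e → a∉K (_ , e) }

  dropTwoPoints : (K : Sub X (suc (suc k))) (a b : X) → Avoiding K k a b
  dropTwoPoints K a b = record
    { index           = λ l → index₁ (index₂ l)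
    ; index-injective = λ e → index₂-injective (index₁-injective e)
    ; avoids-a        = avoids-a₂
    ; avoids-b        = λ l → avoids-b₁ (index₂ l) }
    where
    open Avoiding (dropPoint K b) renaming
      (index to index₁; index-injective to index₁-injective; avoids-a to avoids-b₁; members to K₁)
    open Avoiding (dropPoint K₁ a) renaming
      (index to index₂; index-injective to index₂-injective; avoids-a to avoids-a₂)

  commonClique-of-onlyMissing : {ρ : Rel₀ X} {x y : X} (K : Sub X (suc (suc k))) →
    OnlyMissing ρ K x y → CommonClique ρ k x y
  commonClique-of-onlyMissing {ρ = ρ} {x} {y} K@(f , _) ((i , j , fi≡x , fj≡y) , onlyMissing) = record
    { clique     = members
    ; complete   = λ a b a≢b → dne λ nonEdge →
                     notFirst a (onlyMissing (θ a) (θ b) (λ e → a≢b (θ-inj e)) nonEdge)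
    ; avoids-x   = avoids-x
    ; avoids-y   = avoids-y
    ; adjacent-x = λ l → subst (λ z → ρ z (f (θ l))) fi≡x
                     (adjacent i (λ l e → avoids-x l (trans e fi≡x)) l)
    ; adjacent-y = λ l → subst (λ z → ρ z (f (θ l))) fj≡y
                     (adjacent j (λ l e → avoids-y l (trans e fj≡y)) l) }
    where
    open Avoiding (dropTwoPoints K x y) renaming
      (index to θ; index-injective to θ-inj; avoids-a to avoids-x; avoids-b to avoids-y)

    notFirst : ∀ {v} l → ¬ IsPair x y (f (θ l)) v
    notFirst l = [ (λ (p , _) → avoids-x l p) , (λ (p , _) → avoids-y l p) ]
    notSecond : ∀ {u} l → ¬ IsPair x y u (f (θ l))
    notSecond l = [ (λ (_ , q) → avoids-y l q) , (λ (_ , q) → avoids-x l q) ]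

    adjacent : ∀ i → (∀ l → f (θ l) ≢ f i) → ∀ l → ρ (f i) (f (θ l))
    adjacent i distinct l = dne λ nonEdge →
      notSecond l (onlyMissing i (θ l) (λ e → distinct l (cong f (sym e))) nonEdge)

  -- (a, ⇒) In a maximal K_n-free graph, adding a non-edge {x,y} creates an n-clique;
  -- it must contain x and y, and {x,y} is its only pair missing from ρ.
  saturated-of-maximal : {ρ : Rel₀ X} → MaxKFree n ρ → Saturated n ρ
  saturated-of-maximal {X = X} {n} {ρ} (g , kf , maximal) x y x≢y nonEdge =
    K , onlyMissing-of-complete-addEdge {ρ = ρ} K x∈K y∈K K-complete
    where
    cliqueWithEdge : Σ[ K ∈ Sub X n ] Complete (addEdge ρ x y) K
    cliqueWithEdge = dne λ kf⁺ →
      nonEdge (maximal (addEdge ρ x y) (addEdge-isGraph g x≢y) kf⁺ (λ _ _ → inj₁) x y (inj₂ (inj₁ (refl , refl))))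
    K : Sub X n
    K = proj₁ cliqueWithEdge
    K-complete : Complete (addEdge ρ x y) K
    K-complete = proj₂ cliqueWithEdge

    x∈K : x ∈ₛ K
    x∈K = dne λ x∉K → kf (K , complete-dropEdge {ρ = ρ} {x} {y} K (inj₁ x∉K) K-complete)
    y∈K : y ∈ₛ K
    y∈K = dne λ y∉K → kf (K , complete-dropEdge {ρ = ρ} {x} {y} K (inj₂ y∉K) K-complete)

  commonClique-of-nonEdge : {ρ : Rel₀ X} {x y : X} → Saturated (suc (suc k)) ρ →
    x ≢ y → ¬ ρ x y → CommonClique ρ k x y
  commonClique-of-nonEdge {x = x} {y} saturated x≢y nonEdge =
    let (K , onlyMissing) = saturated x y x≢y nonEdge in commonClique-of-onlyMissing K onlyMissing

  complete-of-onlyMissing : {ρ σ : Rel₀ X} {x y : X} (K : Sub X n) → OnlyMissing ρ K x y →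
    (∀ a b → σ a b → σ b a) → ρ ⊆ᵣ σ → σ x y → Complete σ K
  complete-of-onlyMissing {ρ = ρ} {σ} (f , _) (_ , onlyMissing) σ-sym ρ⊆σ σxy i j i≢j
    with em {ρ (f i) (f j)}
  ... | yes r = ρ⊆σ _ _ r
  ... | no nonEdge with onlyMissing i j i≢j nonEdge
  ...   | inj₁ (p , q) = subst₂ σ (sym p) (sym q) σxy
  ...   | inj₂ (p , q) = subst₂ σ (sym p) (sym q) (σ-sym _ _ σxy)

  -- (a, ⇐) A saturated K_n-free graph is maximal: a new edge would complete an n-clique.
  maximal-of-saturated : {ρ : Rel₀ X} → IsGraph ρ → KFree n ρ → Saturated n ρ → MaxKFree n ρ
  maximal-of-saturated {n = n} {ρ = ρ} g kf saturated = g , kf , maximal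
    where
    maximal : ∀ σ → IsGraph σ → KFree n σ → ρ ⊆ᵣ σ → σ ⊆ᵣ ρ
    maximal σ gσ kσ ρ⊆σ x y σxy = dne λ nonEdge →
      let (K , onlyMissing) = saturated x y (edge⇒distinct gσ σxy) nonEdge
      in kσ (K , complete-of-onlyMissing K onlyMissing (proj₁ gσ) ρ⊆σ σxy)

  -- A saturated graph with at least k+1 vertices has a (k+1)-clique: a common clique of a
  -- non-edge together with one endpoint, or any (k+1)-set if there is no non-edge.
  saturated-has-clique : {ρ : Rel₀ X} → IsGraph ρ → Saturated (suc (suc k)) ρ →
    Sub X (suc k) → Σ[ K ∈ Sub X (suc k) ] Complete ρ K
  saturated-has-clique {X = X} {ρ = ρ} g saturated (h , h-inj)
    with em {Σ[ y ∈ X ] Σ[ z ∈ X ] (y ≢ z × ¬ ρ y z)}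
  ... | yes (y , z , y≢z , nonEdge) =
        let open CommonClique (commonClique-of-nonEdge saturated y≢z nonEdge)
        in extend y clique avoids-x , complete-extend clique avoids-x (proj₁ g) complete adjacent-x
  ... | no noNonEdge =
        (h , h-inj) , λ i j i≢j → dne λ nonEdge → noNonEdge (h i , h j , (λ e → i≢j (h-inj e)) , nonEdge)

  -- (b) In a saturated graph with at least k+1 vertices every x has a common k-clique
  -- with itself: via a non-neighbour of x, or, if x is adjacent to all other vertices,
  -- by deleting x from a (k+1)-clique.
  vertex-commonClique : {ρ : Rel₀ X} → IsGraph ρ → Saturated (suc (suc k)) ρ →
    Sub X (suc k) → (x : X) → CommonClique ρ k x x
  vertex-commonClique {X = X} {ρ = ρ} g saturated H x with em {Σ[ y ∈ X ] (x ≢ y × ¬ ρ x y)}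
  ... | yes (y , x≢y , nonEdge) =
        commonClique-left (commonClique-of-nonEdge saturated x≢y nonEdge)
  ... | no noNonNeighbour with saturated-has-clique g saturated H
  ...   | K , K-complete = record
          { clique = members
          ; complete = complete-restrict {ρ = ρ} K index index-injective K-complete
          ; avoids-x = avoids-a ; avoids-y = avoids-a
          ; adjacent-x = universal ; adjacent-y = universal }
    where
    open Avoiding (dropPoint K x)
    universal : ∀ l → ρ x (proj₁ K (index l))
    universal l = dne λ nonEdge → noNonNeighbour (_ , (λ e → avoids-a l (sym e)) , nonEdge)

  -- Blowing up a saturated graph with at least k+1 vertices keeps it saturated: a
  -- non-edge of the blow-up lies over a non-edge or over a single vertex of ρ, whose
  -- common clique lifts.
  blowUp-saturated : {ρ : Rel₀ X} (Y : X → Set) → (∀ x → Y x) → IsGraph ρ →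
    Saturated (suc (suc k)) ρ → Sub X (suc k) → Saturated (suc (suc k)) (BlowUp ρ Y)
  blowUp-saturated {k = k} {ρ = ρ} Y choice g saturated H p q p≢q nonEdge =
    onlyMissing-of-commonClique (blowUp-isGraph Y g) p≢q (liftCommonClique choice p q base)
    where
    base : CommonClique ρ k (proj₁ p) (proj₁ q)
    base with em {proj₁ p ≡ proj₁ q}
    ... | yes same = subst (CommonClique ρ k (proj₁ p)) same (vertex-commonClique g saturated H (proj₁ p))
    ... | no  different =
          commonClique-of-nonEdge saturated different (λ r → nonEdge (p≢q , r))

  blowUp-maximal : {ρ : Rel₀ X} → MaxKFree (suc (suc k)) ρ → Sub X (suc k) →
    (Y : X → Set) → (∀ x → Y x) → MaxKFree (suc (suc k)) (BlowUp ρ Y)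
  blowUp-maximal max@(g , kf , _) H Y choice =
    maximal-of-saturated (blowUp-isGraph Y g) (blowUp-kFree Y g kf)
      (blowUp-saturated Y choice g (saturated-of-maximal max) H)

  complete-of-diagOn-compl : {σ : Rel₀ X} (K : Sub X n) → DiagOn (compl σ) K → Complete σ K
  complete-of-diagOn-compl (f , f-inj) diagonal i j i≢j =
    dne λ nonEdge → i≢j (f-inj (proj₁ (diagonal i j) nonEdge))

  complete-of-independent-gcompl : {σ : Rel₀ X} (K : Sub X n) → Independent (gcompl σ) K → Complete σ K
  complete-of-independent-gcompl (f , f-inj) independent i j i≢j =
    dne λ nonEdge → independent i j i≢j ((λ e → i≢j (f-inj e)) , nonEdge)

  complDuality : Duality {X} (KFreeGraph n) (DFreeReflGraph n) compl
  complDuality = record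
    { antitone  = λ ρ⊆σ a b nσ r → nσ (ρ⊆σ a b r)
    ; P⇒Q       = λ {ρ} ((ρ-sym , ρ-irr) , kf) →
        ((λ a b nr r → nr (ρ-sym b a r)) , ρ-irr) ,
        λ (K , diagonal) → kf (K , complete-of-diagOn-compl {σ = ρ} K diagonal)
    ; Q⇒P       = λ {θ} ((θ-sym , θ-refl) , df) →
        ((λ a b nt t → nt (θ-sym b a t)) , (λ a nt → nt (θ-refl a))) ,
        λ (K , c) → df (K , diagOn-of-complete-compl {θ = θ} θ-refl K c)
    ; FF-shrink = λ _ _ _ → dne
    ; FF-grow   = λ _ _ _ r nr → nr r }

  gcomplDuality : Duality {X} (KFreeGraph n) (EFreeGraph n) gcompl
  gcomplDuality = record
    { antitone  = λ ρ⊆σ a b (a≢b , nσ) → a≢b , λ r → nσ (ρ⊆σ a b r)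
    ; P⇒Q       = λ {ρ} (g , kf) → gcompl-isGraph (proj₁ g) ,
        λ (K , independent) → kf (K , complete-of-independent-gcompl {σ = ρ} K independent)
    ; Q⇒P       = λ (g , ef) → gcompl-isGraph (proj₁ g) ,
        λ (K , c) → ef (K , λ i j i≢j s → proj₂ (c i j i≢j) s)
    ; FF-shrink = λ _ _ _ (a≢b , nn) → dne λ nσ → nn (a≢b , nσ)
    ; FF-grow   = λ (g , _) _ _ r → edge⇒distinct g r , λ (_ , nr) → nr r }

  maxKFree⇔minDFree : {ρ : Rel₀ X} → KFreeGraph n ρ → MaxKFree n ρ ⇔ MinDFree n (compl ρ)
  maxKFree⇔minDFree P =
    ⇔-sym (minDFree⇔isMinimal (P⇒Q P)) ⇔-∘ (maximal⇔minimal complDuality P ⇔-∘ maxKFree⇔isMaximal P)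
    where open Duality complDuality

  maxKFree⇔minEFree : {ρ : Rel₀ X} → KFreeGraph n ρ → MaxKFree n ρ ⇔ MinEFree n (gcompl ρ)
  maxKFree⇔minEFree P =
    ⇔-sym (minEFree⇔isMinimal (P⇒Q P)) ⇔-∘ (maximal⇔minimal gcomplDuality P ⇔-∘ maxKFree⇔isMaximal P)
    where open Duality gcomplDuality

-- The proof only needs n ≥ 2; write n = k + 2, so that n ∸ 1 = k + 1 and n ∸ 2 = k.
claim5p3 : ExcludedMiddle 0ℓ →
    (n : ℕ) → 3 ≤ n → {X : Set} (ρ : Rel₀ X) → IsGraph ρ → KFree n ρ →
      -- (a)
      (MaxKFree n ρ ⇔
        (∀ (x y : X) → x ≢ y → ¬ ρ x y → Σ[ K ∈ Sub X n ] OnlyMissing ρ K x y))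
    × -- (b)
      (MaxKFree n ρ → CardGE X (n ∸ 1) →
        ∀ (x : X) → Σ[ K ∈ Sub X (n ∸ 2) ]
          ((∀ i → proj₁ K i ≢ x) × Complete ρ K × (∀ i → ρ x (proj₁ K i))))
    × -- (c)
      (MaxKFree n ρ → CardGE X (n ∸ 1) →
        ∀ (Y : X → Set) → (∀ x → Y x) → MaxKFree n (BlowUp ρ Y))
    × -- (d)
      ((MaxKFree n ρ ⇔ MinDFree n (compl ρ))
        × (MinDFree n (compl ρ) ⇔ MinEFree n (gcompl ρ)))
claim5p3 em (suc (suc k)) (s≤s (s≤s _)) ρ g kf =
    mk⇔ saturated-of-maximal (maximal-of-saturated g kf)
  , (λ max H x → let open CommonClique (vertex-commonClique g (saturated-of-maximal max) H x)
                 in clique , avoids-x , complete , adjacent-x)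
  , blowUp-maximal
  , maxKFree⇔minDFree (g , kf)
  , maxKFree⇔minEFree (g , kf) ⇔-∘ ⇔-sym (maxKFree⇔minDFree (g , kf))
  where open Classical em
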